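{- The lattices $\mathcal{L}(\mathbb{Z}_2\times\mathbb{Z}_4)$, $\mathcal{L}(\mathbb{Z}_3\times\mathbb{Z}_3)$ and $\mathcal{L}(\mathbb{Z}_4\times\mathbb{Z}_4)$ are well-rounded with minimum distance $2$.
   Context: For a finite Abelian (additive) group $G=\{0,g_1,\dots,g_n\}$ of order $n+1$ with nonzero elements listed as $g_1,\dots,g_n$, define $$\mathcal{L}(G)=\Big\{X=(x_1,\dots,x_n,-x_1-\cdots-x_n)\in\mathbb{Z}^{n+1}:\ x_1g_1+\cdots+x_ng_n=0\Big\},$$ a lattice of rank $n$. Its minimum distance is $d(G)=\min\{\|X\|: X\in\mathcal{L}(G)\setminus\{0\}\}$ (Euclidean norm); vectors of norm $d(G)$ are minimal vectors. $\mathcal{L}(G)$ is well-rounded if it contains $n$ linearly independent minimal vectors. $\mathbb{Z}_m$ is the cyclic group of order $m$. -}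

module Defs where

open import Data.Nat as ℕ using (ℕ; zero; suc)
open import Data.Integer as ℤ using (ℤ; +_; 0ℤ; _+_; _*_; -_; _≤_)
open import Data.Integer.Divisibility using (_∣_)
open import Data.Fin using (Fin; zero; suc; fromℕ; inject₁)
open import Data.List as List using (List; upTo; concatMap; map; drop; length; lookup)
open import Data.Product using (_×_; _,_; proj₁; proj₂; Σ-syntax)
open import Relation.Binary.PropositionalEquality using (_≡_)
open import Relation.Nullary using (¬_)

∑ : ∀ {n} → (Fin n → ℤ) → ℤ
∑ {zero}  f = 0ℤ
∑ {suc n} f = f zero + ∑ (λ i → f (suc i))

-- The group Z_a × Z_b, elements represented by pairs (i , j) with i < a, j < b,
-- listed lexicographically; the first entry is (0 , 0) (for a, b ≥ 1).
elements : ℕ → ℕ → List (ℕ × ℕ)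
elements a b = concatMap (λ i → map (λ j → (i , j)) (upTo b)) (upTo a)

nonzeroElems : ℕ → ℕ → List (ℕ × ℕ)
nonzeroElems a b = drop 1 (elements a b)

rk : ℕ → ℕ → ℕ
rk a b = length (nonzeroElems a b)

g : (a b : ℕ) → Fin (rk a b) → ℕ × ℕ
g a b = lookup (nonzeroElems a b)

RelZero : (a b : ℕ) → (Fin (rk a b) → ℤ) → Set
RelZero a b x =
  ((+ a) ∣ ∑ (λ k → x k * (+ proj₁ (g a b k)))) ×
  ((+ b) ∣ ∑ (λ k → x k * (+ proj₂ (g a b k))))

Vecℤ : ℕ → Set
Vecℤ m = Fin m → ℤ

InL : (a b : ℕ) → Vecℤ (suc (rk a b)) → Set
InL a b X =
  (X (fromℕ (rk a b)) ≡ - ∑ (λ i → X (inject₁ i))) ×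
  RelZero a b (λ i → X (inject₁ i))

normSq : ∀ {m} → Vecℤ m → ℤ
normSq X = ∑ (λ i → X i * X i)

NonZero : ∀ {m} → Vecℤ m → Set
NonZero X = ¬ (∀ i → X i ≡ 0ℤ)

MinDist2 : (a b : ℕ) → Set
MinDist2 a b =
  (Σ[ X ∈ Vecℤ (suc (rk a b)) ] (InL a b X × NonZero X × normSq X ≡ + 4)) ×
  (∀ (X : Vecℤ (suc (rk a b))) → InL a b X → NonZero X → + 4 ≤ normSq X)

Minimal : (a b : ℕ) → Vecℤ (suc (rk a b)) → Set
Minimal a b X =
  InL a b X × NonZero X ×
  (∀ (Y : Vecℤ (suc (rk a b))) → InL a b Y → NonZero Y → normSq X ≤ normSq Y)

LinIndep : ∀ {k m} → (Fin k → Vecℤ m) → Set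
LinIndep {k} {m} v =
  (c : Fin k → ℤ) → (∀ (j : Fin m) → ∑ (λ i → c i * v i j) ≡ 0ℤ) → ∀ i → c i ≡ 0ℤ

WellRounded : (a b : ℕ) → Set
WellRounded a b =
  Σ[ v ∈ (Fin (rk a b) → Vecℤ (suc (rk a b))) ]
    ((∀ i → Minimal a b (v i)) × LinIndep v)

module Submission where

-- The coordinates of every X ∈ L(G) sum to 0.  A nonzero
-- integer vector with coordinate sum 0 and squared norm < 4 is a root
-- e_p − e_q (classification by induction on the dimension, through
-- "norm one ⇒ unit sum" and "unit sum, norm ≤ 2 ⇒ signed unit vector").
-- If such a root lay in L(G), pairing it with the coordinates of the listing
-- g₁,…,gₙ,0 would give g_p = g_q for two different positions of that listing,
-- which has no repetitions.
--
-- For each group a certificate lists n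
-- vectors e_p + e_q − e_r − e_s of L(G) (each encodes a relation
-- g_p + g_q = g_r + g_s and has squared norm 4) together with an integer
-- matrix M with M·Vᵀ = d·I, d ≠ 0, which proves them linearly independent.
-- The finitely many facts of a certificate are checked by decision procedures.

open import Defs
open import Data.Nat as ℕ using (ℕ; zero; suc; z≤n; s≤s)
import Data.Nat.Properties as ℕP
import Data.Nat.Divisibility as ℕD
open import Data.Integer as ℤ using (ℤ; +_; -[1+_]; 0ℤ; 1ℤ; -1ℤ; _+_; _*_; -_; _-_; ∣_∣; +≤+)
import Data.Integer.Properties as ℤP
open import Data.Integer.Divisibility using (_∣_)
import Data.Nat.Literals as ℕLiterals
import Data.Integer.Literals as ℤLiterals
open import Data.Fin using (Fin; zero; suc; fromℕ; inject₁; toℕ)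
import Data.Fin.Properties as FinP
open import Data.Vec as Vec using (Vec; _∷_; [])
open import Data.Bool using (if_then_else_)
open import Data.Product using (_×_; _,_; proj₁; proj₂; Σ-syntax)
open import Data.Sum using (_⊎_; inj₁; inj₂; reduce; fromInj₁)
open import Data.Empty using (⊥; ⊥-elim)
open import Data.Unit using (tt)
open import Function using (_∘_)
open import Agda.Builtin.FromNat using (Number; fromNat)
open import Agda.Builtin.FromNeg using (Negative; fromNeg)
open import Relation.Binary.PropositionalEquality
open import Relation.Nullary using (Dec; yes; no; ¬_)
open import Relation.Nullary.Decidable using (_→-dec_; _×-dec_; ¬?; toWitness)
open import Algebra.Properties.Semiring.Sum ℤP.+-*-semiring
  using (sum; sum-cong-≗; sum-replicate-zero; ∑-comm; *-distribˡ-sum; sum-init-last)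
open import Algebra.Properties.AbelianGroup ℤP.+-0-abelianGroup using (inverseʳ-unique)

instance
  ℕ-number : Number ℕ
  ℕ-number = ℕLiterals.number

  ℤ-number : Number ℤ
  ℤ-number = ℤLiterals.number

  ℤ-negative : Negative ℤ
  ℤ-negative = ℤLiterals.negative

-- Finite sums.  The sum ∑ of Defs is the library's sum over the semiring ℤ,
-- so its algebraic laws are imported through this identification.

∑≡sum : ∀ {n} (f : Vecℤ n) → ∑ f ≡ sum f
∑≡sum {zero}  f = refl
∑≡sum {suc n} f = cong (_+_ (f zero)) (∑≡sum (f ∘ suc))

∑-cong : ∀ {n} {f h : Vecℤ n} → (∀ i → f i ≡ h i) → ∑ f ≡ ∑ h
∑-cong {f = f} {h} f≗h = trans (∑≡sum f) (trans (sum-cong-≗ f≗h) (sym (∑≡sum h)))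

∑-zero : ∀ {n} {f : Vecℤ n} → (∀ i → f i ≡ 0ℤ) → ∑ f ≡ 0ℤ
∑-zero {n} {f} f≗0 = trans (∑≡sum f) (trans (sum-cong-≗ f≗0) (sum-replicate-zero n))

∑-init-last : ∀ {m} (f : Vecℤ (suc m)) → ∑ f ≡ ∑ (f ∘ inject₁) + f (fromℕ m)
∑-init-last {m} f = trans (∑≡sum f) (trans (sum-init-last f) (cong (_+ f (fromℕ m)) (sym (∑≡sum (f ∘ inject₁)))))

*-distribˡ-∑ : ∀ {n} (c : ℤ) (f : Vecℤ n) → c * ∑ f ≡ ∑ (λ i → c * f i)
*-distribˡ-∑ c f = trans (cong (c *_) (∑≡sum f)) (trans (*-distribˡ-sum c f) (sym (∑≡sum (λ i → c * f i))))

∑-swap : ∀ {n m} (f : Fin n → Fin m → ℤ) →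
         ∑ (λ i → ∑ (λ j → f i j)) ≡ ∑ (λ j → ∑ (λ i → f i j))
∑-swap f = begin
  ∑ (λ i → ∑ (f i))              ≡⟨ trans (∑-cong (λ i → ∑≡sum (f i))) (∑≡sum (λ i → sum (f i))) ⟩
  sum (λ i → sum (f i))          ≡⟨ ∑-comm f ⟩
  sum (λ j → sum (λ i → f i j))  ≡⟨ sym (trans (∑-cong (λ j → ∑≡sum (λ i → f i j))) (∑≡sum (λ j → sum (λ i → f i j)))) ⟩
  ∑ (λ j → ∑ (λ i → f i j))      ∎
  where open ≡-Reasoning

∑-single : ∀ {n} (f : Vecℤ n) (i : Fin n) → (∀ l → l ≢ i → f l ≡ 0ℤ) → ∑ f ≡ f i
∑-single f zero others =
  trans (cong (_+_ (f zero)) (∑-zero (λ l → others (suc l) (λ ())))) (ℤP.+-identityʳ (f zero))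
∑-single f (suc i) others =
  trans (cong (_+ ∑ (f ∘ suc)) (others zero (λ ())))
        (trans (ℤP.+-identityˡ (∑ (f ∘ suc))) (∑-single (f ∘ suc) i (λ l l≢i → others (suc l) (l≢i ∘ FinP.suc-injective))))

⟨_,_⟩ : ∀ {m} → Vecℤ m → Vecℤ m → ℤ
⟨ Y , h ⟩ = ∑ (λ k → Y k * h k)

⟨⟩-linear : ∀ {k m} (w : Vecℤ m) (c : Vecℤ k) (v : Fin k → Vecℤ m) →
            ⟨ w , (λ j → ∑ (λ l → c l * v l j)) ⟩ ≡ ∑ (λ l → c l * ⟨ w , v l ⟩)
⟨⟩-linear w c v = begin
  ∑ (λ j → w j * ∑ (λ l → c l * v l j))     ≡⟨ ∑-cong (λ j → *-distribˡ-∑ (w j) (λ l → c l * v l j)) ⟩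
  ∑ (λ j → ∑ (λ l → w j * (c l * v l j)))   ≡⟨ ∑-swap (λ j l → w j * (c l * v l j)) ⟩
  ∑ (λ l → ∑ (λ j → w j * (c l * v l j)))   ≡⟨ ∑-cong (λ l → ∑-cong (λ j → exchange (w j) (c l) (v l j))) ⟩
  ∑ (λ l → ∑ (λ j → c l * (w j * v l j)))   ≡⟨ ∑-cong (λ l → sym (*-distribˡ-∑ (c l) (λ j → w j * v l j))) ⟩
  ∑ (λ l → c l * ⟨ w , v l ⟩)               ∎
  where
  open ≡-Reasoning
  exchange : ∀ x y z → x * (y * z) ≡ y * (x * z)
  exchange x y z = trans (sym (ℤP.*-assoc x y z)) (trans (cong (_* z) (ℤP.*-comm x y)) (ℤP.*-assoc y x z))

‖_‖² : ∀ {m} → Vecℤ m → ℕ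
‖_‖² {zero}  Y = 0
‖_‖² {suc m} Y = ∣ Y zero ∣ ℕ.* ∣ Y zero ∣ ℕ.+ ‖ Y ∘ suc ‖²

normSq≡‖‖² : ∀ {m} (Y : Vecℤ m) → normSq Y ≡ + ‖ Y ‖²
normSq≡‖‖² {zero}  Y = refl
normSq≡‖‖² {suc m} Y = cong₂ _+_ (square≡∣∣² (Y zero)) (normSq≡‖‖² (Y ∘ suc))
  where
  square≡∣∣² : ∀ y → y * y ≡ + (∣ y ∣ ℕ.* ∣ y ∣)
  square≡∣∣² (+ n)    = ℤP.+◃n≡+n (n ℕ.* n)
  square≡∣∣² -[1+ n ] = refl

norm0⇒zero : ∀ {m} (Y : Vecℤ m) → ‖ Y ‖² ≡ 0 → ∀ k → Y k ≡ 0ℤ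
norm0⇒zero {suc m} Y ‖Y‖²≡0 zero =
  ℤP.∣i∣≡0⇒i≡0 (reduce (ℕP.m*n≡0⇒m≡0∨n≡0 ∣ Y zero ∣ (ℕP.m+n≡0⇒m≡0 _ ‖Y‖²≡0)))
norm0⇒zero {suc m} Y ‖Y‖²≡0 (suc k) =
  norm0⇒zero (Y ∘ suc) (ℕP.m+n≡0⇒n≡0 (∣ Y zero ∣ ℕ.* ∣ Y zero ∣) ‖Y‖²≡0) k

norm0⇒∑≡0 : ∀ {m} (Y : Vecℤ m) → ‖ Y ‖² ≡ 0 → ∑ Y ≡ 0ℤ
norm0⇒∑≡0 Y ‖Y‖²≡0 = ∑-zero (norm0⇒zero Y ‖Y‖²≡0)

norm0⇒⟨⟩≡0 : ∀ {m} (Y : Vecℤ m) → ‖ Y ‖² ≡ 0 → ∀ h → ⟨ Y , h ⟩ ≡ 0ℤ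
norm0⇒⟨⟩≡0 Y ‖Y‖²≡0 h = ∑-zero (λ k → cong (_* h k) (norm0⇒zero Y ‖Y‖²≡0 k))

bigCoordinate : ∀ n s → ¬ (suc (suc n) ℕ.* suc (suc n) ℕ.+ s ℕ.≤ 3)
bigCoordinate n s ≤3 = ℕP.<-irrefl refl (ℕP.≤-trans 4≤ ≤3)
  where
  4≤ : 4 ℕ.≤ suc (suc n) ℕ.* suc (suc n) ℕ.+ s
  4≤ = ℕP.≤-trans (ℕP.*-mono-≤ {2} {suc (suc n)} {2} (s≤s (s≤s z≤n)) (s≤s (s≤s z≤n))) (ℕP.m≤m+n _ s)

IsUnit : ℤ → Set
IsUnit y = y ≡ 1ℤ ⊎ y ≡ -1ℤ

unit≢0 : ∀ {ε} → IsUnit ε → ε ≢ 0ℤ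
unit≢0 (inj₁ refl) ()
unit≢0 (inj₂ refl) ()

-- Parity: a sum of two units is never a unit.
unit+unit≢unit : ∀ {y u ε} → IsUnit y → IsUnit u → IsUnit ε → y + u ≢ ε
unit+unit≢unit (inj₁ refl) (inj₁ refl) (inj₁ refl) ()
unit+unit≢unit (inj₁ refl) (inj₁ refl) (inj₂ refl) ()
unit+unit≢unit (inj₁ refl) (inj₂ refl) (inj₁ refl) ()
unit+unit≢unit (inj₁ refl) (inj₂ refl) (inj₂ refl) ()
unit+unit≢unit (inj₂ refl) (inj₁ refl) (inj₁ refl) ()
unit+unit≢unit (inj₂ refl) (inj₁ refl) (inj₂ refl) ()
unit+unit≢unit (inj₂ refl) (inj₂ refl) (inj₁ refl) ()
unit+unit≢unit (inj₂ refl) (inj₂ refl) (inj₂ refl) ()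

-- Y acts on test vectors as ε·e_p; testing with indicator vectors shows this
-- is the same as Y = ε·e_p.
SignedUnit : ∀ {m} → Vecℤ m → ℤ → Fin m → Set
SignedUnit Y ε p = ∀ h → ⟨ Y , h ⟩ ≡ ε * h p

-- Y acts on test vectors as the root e_p − e_q of the lattice A_{m-1}.
Root : ∀ {m} → Vecℤ m → Fin m → Fin m → Set
Root Y p q = ∀ h → ⟨ Y , h ⟩ ≡ h p - h q

norm1⇒unitSum : ∀ {m} (Y : Vecℤ m) → ‖ Y ‖² ≡ 1 → IsUnit (∑ Y)
norm1⇒unitSum {suc m} Y = onHead (Y zero) (Y ∘ suc)
  where
  unitHead : ∀ {y} (T : Vecℤ m) → IsUnit y → ‖ T ‖² ≡ 0 → IsUnit (y + ∑ T)
  unitHead {y} T unit ‖T‖²≡0 =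
    subst (λ s → IsUnit (y + s)) (sym (norm0⇒∑≡0 T ‖T‖²≡0))
          (subst IsUnit (sym (ℤP.+-identityʳ y)) unit)
  onHead : ∀ y (T : Vecℤ m) → ∣ y ∣ ℕ.* ∣ y ∣ ℕ.+ ‖ T ‖² ≡ 1 → IsUnit (y + ∑ T)
  onHead (+ 0)           T norm≡1 = subst IsUnit (sym (ℤP.+-identityˡ (∑ T))) (norm1⇒unitSum T norm≡1)
  onHead (+ 1)           T norm≡1 = unitHead T (inj₁ refl) (ℕP.suc-injective norm≡1)
  onHead -[1+ 0 ]        T norm≡1 = unitHead T (inj₂ refl) (ℕP.suc-injective norm≡1)
  onHead (+ suc (suc n)) T ()
  onHead -[1+ suc n ]    T ()

unitSum⇒signedUnit : ∀ {m} (Y : Vecℤ m) {ε} → IsUnit ε → ∑ Y ≡ ε → ‖ Y ‖² ℕ.≤ 2 →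
                     Σ[ p ∈ Fin m ] SignedUnit Y ε p
unitSum⇒signedUnit {zero}  Y unit ∑Y≡ε _ = ⊥-elim (unit≢0 unit (sym ∑Y≡ε))
unitSum⇒signedUnit {suc m} Y = onHead (Y zero) (Y ∘ suc)
  where
  Result : ℤ → Vecℤ m → ℤ → Set
  Result y T ε = Σ[ p ∈ Fin (suc m) ] (∀ h → y * h zero + ⟨ T , h ∘ suc ⟩ ≡ ε * h p)

  -- With a unit head the tail must vanish: a tail of norm 1 would make the sum even.
  unitHead : ∀ {y ε} (T : Vecℤ m) → IsUnit y → IsUnit ε → y + ∑ T ≡ ε → ‖ T ‖² ℕ.≤ 1 → Result y T ε
  unitHead {y} {ε} T unitY unitε sum≡ε ‖T‖²≤1 with ‖ T ‖² in norm≡ | ‖T‖²≤1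
  ... | 0 | _ = zero , λ h → begin
    y * h zero + ⟨ T , h ∘ suc ⟩  ≡⟨ cong (_+_ (y * h zero)) (norm0⇒⟨⟩≡0 T norm≡ (h ∘ suc)) ⟩
    y * h zero + 0ℤ               ≡⟨ ℤP.+-identityʳ (y * h zero) ⟩
    y * h zero                    ≡⟨ cong (_* h zero) y≡ε ⟩
    ε * h zero                    ∎
    where
    open ≡-Reasoning
    y≡ε : y ≡ ε
    y≡ε = trans (sym (ℤP.+-identityʳ y)) (trans (cong (_+_ y) (sym (norm0⇒∑≡0 T norm≡))) sum≡ε)
  ... | 1 | _ = ⊥-elim (unit+unit≢unit unitY (norm1⇒unitSum T norm≡) unitε sum≡ε)
  ... | suc (suc _) | s≤s ()

  onHead : ∀ y (T : Vecℤ m) {ε} → IsUnit ε → y + ∑ T ≡ ε →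
           ∣ y ∣ ℕ.* ∣ y ∣ ℕ.+ ‖ T ‖² ℕ.≤ 2 → Result y T ε
  onHead (+ 0) T unit sum≡ε ‖T‖²≤2 =
    let (p , act) = unitSum⇒signedUnit T unit (trans (sym (ℤP.+-identityˡ (∑ T))) sum≡ε) ‖T‖²≤2
    in suc p , λ h → trans (ℤP.+-identityˡ ⟨ T , h ∘ suc ⟩) (act (h ∘ suc))
  onHead (+ 1)           T unit sum≡ε (s≤s ‖T‖²≤1) = unitHead T (inj₁ refl) unit sum≡ε ‖T‖²≤1
  onHead -[1+ 0 ]        T unit sum≡ε (s≤s ‖T‖²≤1) = unitHead T (inj₂ refl) unit sum≡ε ‖T‖²≤1
  onHead (+ suc (suc n)) T _ _ ‖Y‖²≤2 = ⊥-elim (bigCoordinate n _ (ℕP.m≤n⇒m≤1+n ‖Y‖²≤2))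
  onHead -[1+ suc n ]    T _ _ ‖Y‖²≤2 = ⊥-elim (bigCoordinate n _ (ℕP.m≤n⇒m≤1+n ‖Y‖²≤2))

shortZeroSum⇒root : ∀ {m} (Y : Vecℤ m) → ∑ Y ≡ 0ℤ → ‖ Y ‖² ℕ.< 4 → NonZero Y →
                    Σ[ p ∈ Fin m ] Σ[ q ∈ Fin m ] (p ≢ q × Root Y p q)
shortZeroSum⇒root {zero}  Y _ _ Y≢0 = ⊥-elim (Y≢0 (λ ()))
shortZeroSum⇒root {suc m} Y ∑Y≡0 ‖Y‖²<4 Y≢0 =
  onHead (Y zero) (Y ∘ suc) ∑Y≡0 ‖Y‖²<4 (λ y≡0 T≡0 → Y≢0 (λ { zero → y≡0 ; (suc k) → T≡0 k }))
  where
  Result : ℤ → Vecℤ m → Set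
  Result y T = Σ[ p ∈ Fin (suc m) ] Σ[ q ∈ Fin (suc m) ]
                 (p ≢ q × (∀ h → y * h zero + ⟨ T , h ∘ suc ⟩ ≡ h p - h q))

  onHead : ∀ y (T : Vecℤ m) → y + ∑ T ≡ 0ℤ → ∣ y ∣ ℕ.* ∣ y ∣ ℕ.+ ‖ T ‖² ℕ.< 4 →
           (y ≡ 0ℤ → (∀ k → T k ≡ 0ℤ) → ⊥) → Result y T
  onHead (+ 0) T sum≡0 ‖T‖²<4 nonzero =
    let (p , q , p≢q , root) = shortZeroSum⇒root T (trans (sym (ℤP.+-identityˡ (∑ T))) sum≡0) ‖T‖²<4 (nonzero refl)
    in suc p , suc q , p≢q ∘ FinP.suc-injective , λ h → trans (ℤP.+-identityˡ ⟨ T , h ∘ suc ⟩) (root (h ∘ suc))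
  onHead (+ 1) T sum≡0 (s≤s (s≤s ‖T‖²≤2)) _
    with unitSum⇒signedUnit T (inj₂ refl) (inverseʳ-unique 1ℤ (∑ T) sum≡0) ‖T‖²≤2
  ... | p , act = zero , suc p , (λ ()) , λ h →
    cong₂ _+_ (ℤP.*-identityˡ (h zero)) (trans (act (h ∘ suc)) (ℤP.-1*i≡-i (h (suc p))))
  onHead -[1+ 0 ] T sum≡0 (s≤s (s≤s ‖T‖²≤2)) _
    with unitSum⇒signedUnit T (inj₁ refl) (inverseʳ-unique -1ℤ (∑ T) sum≡0) ‖T‖²≤2
  ... | p , act = suc p , zero , (λ ()) , λ h →
    trans (cong₂ _+_ (ℤP.-1*i≡-i (h zero)) (trans (act (h ∘ suc)) (ℤP.*-identityˡ (h (suc p)))))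
          (ℤP.+-comm (- h zero) (h (suc p)))
  onHead (+ suc (suc n)) T _ ‖Y‖²<4 _ = ⊥-elim (bigCoordinate n _ (ℕP.≤-pred ‖Y‖²<4))
  onHead -[1+ suc n ]    T _ ‖Y‖²<4 _ = ⊥-elim (bigCoordinate n _ (ℕP.≤-pred ‖Y‖²<4))

extendByZero : ∀ {m} → Vecℤ m → Vecℤ (suc m)
extendByZero {zero}  h zero    = 0ℤ
extendByZero {suc m} h zero    = h zero
extendByZero {suc m} h (suc i) = extendByZero (h ∘ suc) i

extendByZero-inject₁ : ∀ {m} (h : Vecℤ m) k → extendByZero h (inject₁ k) ≡ h k
extendByZero-inject₁ {suc m} h zero    = refl
extendByZero-inject₁ {suc m} h (suc k) = extendByZero-inject₁ (h ∘ suc) k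

extendByZero-last : ∀ {m} (h : Vecℤ m) → extendByZero h (fromℕ m) ≡ 0ℤ
extendByZero-last {zero}  h = refl
extendByZero-last {suc m} h = extendByZero-last (h ∘ suc)

⟨⟩-extendByZero : ∀ {m} (X : Vecℤ (suc m)) (h : Vecℤ m) →
                  ⟨ X , extendByZero h ⟩ ≡ ⟨ X ∘ inject₁ , h ⟩
⟨⟩-extendByZero {m} X h = begin
  ⟨ X , extendByZero h ⟩
    ≡⟨ ∑-init-last (λ k → X k * extendByZero h k) ⟩
  ∑ (λ k → X (inject₁ k) * extendByZero h (inject₁ k)) + X (fromℕ m) * extendByZero h (fromℕ m)
    ≡⟨ cong₂ _+_ (∑-cong (λ k → cong (X (inject₁ k) *_) (extendByZero-inject₁ h k)))
                 (trans (cong (X (fromℕ m) *_) (extendByZero-last h)) (ℤP.*-zeroʳ (X (fromℕ m)))) ⟩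
  ⟨ X ∘ inject₁ , h ⟩ + 0ℤ
    ≡⟨ ℤP.+-identityʳ ⟨ X ∘ inject₁ , h ⟩ ⟩
  ⟨ X ∘ inject₁ , h ⟩ ∎
  where open ≡-Reasoning

lastIsMinusSum⇒∑≡0 : ∀ {m} (X : Vecℤ (suc m)) → X (fromℕ m) ≡ - ∑ (X ∘ inject₁) → ∑ X ≡ 0ℤ
lastIsMinusSum⇒∑≡0 X last≡ =
  trans (∑-init-last X) (trans (cong (_+_ (∑ (X ∘ inject₁))) last≡) (ℤP.+-inverseʳ (∑ (X ∘ inject₁))))

listing₁ listing₂ : (a b : ℕ) → Vecℤ (suc (rk a b))
listing₁ a b = extendByZero (λ k → + proj₁ (g a b k))
listing₂ a b = extendByZero (λ k → + proj₂ (g a b k))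

DistinctListing : ℕ → ℕ → Set
DistinctListing a b = ∀ p q → (+ a) ∣ listing₁ a b p - listing₁ a b q →
                              (+ b) ∣ listing₂ a b p - listing₂ a b q → p ≡ q

root-relation : ∀ {m} (X : Vecℤ (suc m)) {p q} → Root X p q →
                ∀ c (h : Vecℤ m) → c ∣ ⟨ X ∘ inject₁ , h ⟩ → c ∣ extendByZero h p - extendByZero h q
root-relation X root c h c∣ = subst (c ∣_) (trans (sym (⟨⟩-extendByZero X h)) (root (extendByZero h))) c∣

normSq≥4 : ∀ a b → DistinctListing a b → ∀ X → InL a b X → NonZero X → + 4 ℤ.≤ normSq X
normSq≥4 a b distinct X (last≡ , a∣ , b∣) X≢0 rewrite normSq≡‖‖² X with 4 ℕ.≤? ‖ X ‖²
... | yes 4≤‖X‖² = +≤+ 4≤‖X‖²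
... | no 4≰‖X‖²
  with shortZeroSum⇒root X (lastIsMinusSum⇒∑≡0 X last≡) (ℕP.≰⇒> 4≰‖X‖²) X≢0
... | p , q , p≢q , root =
  ⊥-elim (p≢q (distinct p q (root-relation X root (+ a) _ a∣) (root-relation X root (+ b) _ b∣)))

NormFour : (a b : ℕ) → Vecℤ (suc (rk a b)) → Set
NormFour a b X = InL a b X × NonZero X × normSq X ≡ + 4

normFour⇒minimal : ∀ a b → DistinctListing a b → ∀ X → NormFour a b X → Minimal a b X
normFour⇒minimal a b distinct X (X∈L , X≢0 , ‖X‖²≡4) =
  X∈L , X≢0 , λ Y Y∈L Y≢0 → subst (ℤ._≤ normSq Y) (sym ‖X‖²≡4) (normSq≥4 a b distinct Y Y∈L Y≢0)

ScaledLeftInverse : ∀ {k m} → (M v : Fin k → Vecℤ m) → ℤ → Set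
ScaledLeftInverse M v d = ∀ i l → (i ≡ l → ⟨ M i , v l ⟩ ≡ d) × (i ≢ l → ⟨ M i , v l ⟩ ≡ 0ℤ)

-- A scaled left inverse with d ≠ 0 certifies linear independence: pairing a
-- vanishing combination ∑ₗ cₗvₗ with row i of M gives cᵢ·d = 0.
leftInverse⇒linIndep : ∀ {k m} (M v : Fin k → Vecℤ m) d → d ≢ 0ℤ →
                       ScaledLeftInverse M v d → LinIndep v
leftInverse⇒linIndep M v d d≢0 inverse c combination≡0 i =
  fromInj₁ (⊥-elim ∘ d≢0) (ℤP.i*j≡0⇒i≡0∨j≡0 (c i) cᵢd≡0)
  where
  open ≡-Reasoning
  offDiagonal : ∀ l → l ≢ i → c l * ⟨ M i , v l ⟩ ≡ 0ℤ
  offDiagonal l l≢i = trans (cong (c l *_) (proj₂ (inverse i l) (l≢i ∘ sym))) (ℤP.*-zeroʳ (c l))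
  cᵢd≡0 : c i * d ≡ 0ℤ
  cᵢd≡0 = begin
    c i * d                                   ≡⟨ cong (c i *_) (sym (proj₁ (inverse i i) refl)) ⟩
    c i * ⟨ M i , v i ⟩                       ≡⟨ sym (∑-single (λ l → c l * ⟨ M i , v l ⟩) i offDiagonal) ⟩
    ∑ (λ l → c l * ⟨ M i , v l ⟩)             ≡⟨ sym (⟨⟩-linear (M i) c v) ⟩
    ⟨ M i , (λ j → ∑ (λ l → c l * v l j)) ⟩  ≡⟨ ∑-zero (λ j → trans (cong (M i j *_) (combination≡0 j)) (ℤP.*-zeroʳ (M i j))) ⟩
    0ℤ                                        ∎

record Certificate (a b : ℕ) : Set where
  field
    vectors : Fin (rk a b) → Vecℤ (suc (rk a b))
    inverse : Fin (rk a b) → Vecℤ (suc (rk a b))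
    scale   : ℤ

Valid : ∀ {a b} → Certificate a b → Set
Valid {a} {b} C =
  DistinctListing a b × (∀ i → NormFour a b (vectors i)) × scale ≢ 0ℤ × ScaledLeftInverse inverse vectors scale
  where open Certificate C

-- A valid certificate proves that L(Z_a × Z_b) is well-rounded with d = 2;
-- the index i₀ only records that n ≥ 1.
certified : ∀ {a b} (C : Certificate a b) → Valid C → Fin (rk a b) → WellRounded a b × MinDist2 a b
certified {a} {b} C (distinct , normFour , scale≢0 , leftInverse) i₀ =
  (vectors , (λ i → normFour⇒minimal a b distinct (vectors i) (normFour i)) ,
             leftInverse⇒linIndep inverse vectors scale scale≢0 leftInverse) ,
  (vectors i₀ , normFour i₀) , normSq≥4 a b distinct
  where open Certificate C

_∣?_ : ∀ i j → Dec (i ∣ j)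
i ∣? j = ∣ i ∣ ℕD.∣? ∣ j ∣

-- Validity of a certificate is decidable, so it can be checked by evaluation.
valid? : ∀ {a b} (C : Certificate a b) → Dec (Valid C)
valid? {a} {b} C = distinct? ×-dec FinP.all? (normFour? ∘ vectors) ×-dec ¬? (scale ℤP.≟ 0ℤ) ×-dec leftInverse?
  where
  open Certificate C
  distinct? : Dec (DistinctListing a b)
  distinct? = FinP.all? λ p → FinP.all? λ q →
    ((+ a) ∣? (listing₁ a b p - listing₁ a b q)) →-dec
    (((+ b) ∣? (listing₂ a b p - listing₂ a b q)) →-dec (p FinP.≟ q))
  normFour? : ∀ X → Dec (NormFour a b X)
  normFour? X =
    ((X (fromℕ (rk a b)) ℤP.≟ - ∑ (X ∘ inject₁)) ×-dec
      (((+ a) ∣? ⟨ X ∘ inject₁ , (λ k → + proj₁ (g a b k)) ⟩) ×-dec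
       ((+ b) ∣? ⟨ X ∘ inject₁ , (λ k → + proj₂ (g a b k)) ⟩))) ×-dec
    ¬? (FinP.all? λ i → X i ℤP.≟ 0ℤ) ×-dec
    (normSq X ℤP.≟ + 4)
  leftInverse? : Dec (ScaledLeftInverse inverse vectors scale)
  leftInverse? = FinP.all? λ i → FinP.all? λ l →
    ((i FinP.≟ l) →-dec (⟨ inverse i , vectors l ⟩ ℤP.≟ scale)) ×-dec
    (¬? (i FinP.≟ l) →-dec (⟨ inverse i , vectors l ⟩ ℤP.≟ 0ℤ))

unitVector : ∀ {m} → ℕ → Vecℤ m
unitVector p k = if toℕ k ℕ.≡ᵇ p then 1ℤ else 0ℤ

-- e_p + e_q − e_r − e_s, the vector encoding the relation g_p + g_q = g_r + g_s
-- (positions count from 0, and the last position stands for the element 0).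
relation : ∀ {m} (p q r s : ℕ) → Vecℤ m
relation p q r s k = unitVector p k + unitVector q k - unitVector r k - unitVector s k

rows : ∀ {k m} → Vec (Vec ℤ m) k → Fin k → Vecℤ m
rows M i j = Vec.lookup (Vec.lookup M i) j

-- Z_2 × Z_4: positions 0–6 list (0,1), (0,2), (0,3), (1,0), (1,1), (1,2), (1,3); position 7 is 0.
certificate24 : Certificate 2 4
certificate24 = record
  { vectors = Vec.lookup
      ( relation 2 7 3 6
      ∷ relation 2 7 4 5
      ∷ relation 0 1 4 5
      ∷ relation 0 4 5 7
      ∷ relation 1 4 6 7
      ∷ relation 1 3 2 6
      ∷ relation 0 5 1 4
      ∷ [])
  ; inverse = rows
      ( ( 0 ∷ -1 ∷ -2 ∷ -3 ∷  0 ∷ -1 ∷ -2 ∷  1 ∷ [])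
      ∷ ( 0 ∷  0 ∷  4 ∷  4 ∷  0 ∷  0 ∷  0 ∷  0 ∷ [])
      ∷ ( 0 ∷  1 ∷ -2 ∷ -3 ∷ -2 ∷ -1 ∷  0 ∷ -1 ∷ [])
      ∷ ( 0 ∷ -3 ∷ -2 ∷ -1 ∷  0 ∷ -3 ∷ -2 ∷ -1 ∷ [])
      ∷ ( 0 ∷  2 ∷  4 ∷  2 ∷  0 ∷  2 ∷  0 ∷ -2 ∷ [])
      ∷ ( 0 ∷ -1 ∷ -2 ∷  1 ∷  0 ∷ -1 ∷ -2 ∷  1 ∷ [])
      ∷ ( 0 ∷ -2 ∷  0 ∷  0 ∷ -2 ∷  0 ∷ -2 ∷ -2 ∷ [])
      ∷ [])
  ; scale = 4
  }

-- Z_3 × Z_3: positions 0–7 list (0,1), (0,2), (1,0), (1,1), (1,2), (2,0), (2,1), (2,2); position 8 is 0.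
certificate33 : Certificate 3 3
certificate33 = record
  { vectors = Vec.lookup
      ( relation 1 4 5 6
      ∷ relation 1 8 3 6
      ∷ relation 0 6 1 5
      ∷ relation 0 2 3 8
      ∷ relation 0 1 4 6
      ∷ relation 0 5 6 8
      ∷ relation 3 5 4 7
      ∷ relation 0 2 5 6
      ∷ [])
  ; inverse = rows
      ( ( 0 ∷  1 ∷ -1 ∷  0 ∷  1 ∷ -1 ∷  0 ∷ -2 ∷ -1 ∷ [])
      ∷ ( 0 ∷ -1 ∷ -1 ∷ -2 ∷  0 ∷  0 ∷ -1 ∷ -2 ∷  1 ∷ [])
      ∷ ( 0 ∷ -2 ∷ -3 ∷ -2 ∷ -1 ∷ -2 ∷ -1 ∷ -3 ∷ -1 ∷ [])
      ∷ ( 0 ∷  1 ∷  1 ∷ -1 ∷  0 ∷  0 ∷  1 ∷ -1 ∷ -1 ∷ [])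
      ∷ ( 0 ∷  1 ∷ -1 ∷  0 ∷ -2 ∷ -1 ∷  0 ∷  1 ∷ -1 ∷ [])
      ∷ ( 0 ∷ -2 ∷ -2 ∷ -1 ∷  0 ∷  0 ∷ -2 ∷ -1 ∷ -1 ∷ [])
      ∷ ( 0 ∷  0 ∷  0 ∷  0 ∷  0 ∷  0 ∷  0 ∷ -3 ∷  0 ∷ [])
      ∷ ( 0 ∷ -1 ∷  2 ∷  1 ∷  0 ∷  0 ∷ -1 ∷  1 ∷  1 ∷ [])
      ∷ [])
  ; scale = 3
  }

-- Z_4 × Z_4: positions 0–14 list (0,1), (0,2), (0,3), (1,0), (1,1), (1,2), (1,3), (2,0), (2,1), (2,2), (2,3), (3,0), (3,1), (3,2), (3,3); position 15 is 0.
certificate44 : Certificate 4 4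
certificate44 = record
  { vectors = Vec.lookup
      ( relation 7 13 8 12
      ∷ relation 4 10 11 15
      ∷ relation 2 12 4 10
      ∷ relation 6 15 10 11
      ∷ relation 1 12 2 11
      ∷ relation 5 8 6 7
      ∷ relation 5 14 6 13
      ∷ relation 3 10 5 8
      ∷ relation 4 9 14 15
      ∷ relation 9 12 10 11
      ∷ relation 0 11 4 7
      ∷ relation 2 14 6 10
      ∷ relation 5 9 11 15
      ∷ relation 0 4 5 15
      ∷ relation 3 13 7 9
      ∷ [])
  ; inverse = rows
      ( ( 0 ∷ -3 ∷ -2 ∷ -3 ∷ -2 ∷ -1 ∷ -4 ∷ -1 ∷ -4 ∷ -3 ∷ -2 ∷ -3 ∷ -2 ∷ -1 ∷ -4 ∷ -1 ∷ [])
      ∷ ( 0 ∷ -1 ∷  2 ∷ -5 ∷  2 ∷  1 ∷  0 ∷ -3 ∷ -4 ∷ -1 ∷  2 ∷ -1 ∷  2 ∷  1 ∷  0 ∷  1 ∷ [])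
      ∷ ( 0 ∷ -2 ∷  0 ∷ -1 ∷ -3 ∷ -1 ∷ -3 ∷  0 ∷ -2 ∷ -4 ∷ -2 ∷ -3 ∷ -1 ∷ -3 ∷ -5 ∷ -2 ∷ [])
      ∷ ( 0 ∷  0 ∷  0 ∷ -1 ∷ -1 ∷ -1 ∷ -1 ∷ -2 ∷ -2 ∷ -2 ∷ -2 ∷ -3 ∷ -3 ∷ -3 ∷ -3 ∷  0 ∷ [])
      ∷ ( 0 ∷  4 ∷  0 ∷  0 ∷  0 ∷  0 ∷  0 ∷  0 ∷  0 ∷  0 ∷  0 ∷  0 ∷  0 ∷  0 ∷  0 ∷  0 ∷ [])
      ∷ ( 0 ∷ -3 ∷ -2 ∷ -1 ∷ -4 ∷ -3 ∷ -6 ∷ -1 ∷  0 ∷ -3 ∷ -2 ∷ -5 ∷ -4 ∷ -3 ∷ -6 ∷ -1 ∷ [])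
      ∷ ( 0 ∷ -3 ∷ -2 ∷ -1 ∷  0 ∷  1 ∷ -2 ∷ -1 ∷ -4 ∷ -3 ∷ -2 ∷ -1 ∷  0 ∷ -3 ∷ -2 ∷ -1 ∷ [])
      ∷ ( 0 ∷  0 ∷  0 ∷  2 ∷ -2 ∷ -2 ∷ -2 ∷  0 ∷  0 ∷  0 ∷  0 ∷ -2 ∷ -2 ∷ -2 ∷ -2 ∷  0 ∷ [])
      ∷ ( 0 ∷  3 ∷  2 ∷  0 ∷  3 ∷  2 ∷  1 ∷ -1 ∷ -2 ∷  1 ∷  0 ∷  2 ∷  1 ∷  0 ∷ -1 ∷  1 ∷ [])
      ∷ ( 0 ∷ -5 ∷ -2 ∷ -2 ∷  1 ∷  0 ∷ -1 ∷ -1 ∷ -2 ∷  1 ∷  0 ∷  0 ∷  3 ∷  2 ∷  1 ∷  1 ∷ [])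
      ∷ ( 0 ∷  0 ∷  0 ∷ -4 ∷  0 ∷  0 ∷  0 ∷ -4 ∷ -4 ∷  0 ∷  0 ∷  0 ∷  0 ∷  0 ∷  0 ∷  0 ∷ [])
      ∷ ( 0 ∷  6 ∷  4 ∷  1 ∷  3 ∷  1 ∷  3 ∷  0 ∷  2 ∷  4 ∷  2 ∷  3 ∷  1 ∷  3 ∷  5 ∷  2 ∷ [])
      ∷ ( 0 ∷  2 ∷  0 ∷  4 ∷ -2 ∷  0 ∷  2 ∷  2 ∷  4 ∷  2 ∷  0 ∷  0 ∷ -2 ∷  0 ∷  2 ∷ -2 ∷ [])
      ∷ ( 0 ∷ -4 ∷ -4 ∷  0 ∷ -4 ∷ -4 ∷ -4 ∷  0 ∷  0 ∷ -4 ∷ -4 ∷ -4 ∷ -4 ∷ -4 ∷ -4 ∷ -4 ∷ [])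
      ∷ ( 0 ∷  0 ∷  0 ∷  2 ∷  2 ∷  2 ∷  2 ∷  0 ∷  0 ∷  0 ∷  0 ∷  2 ∷  2 ∷  2 ∷  2 ∷  0 ∷ [])
      ∷ [])
  ; scale = 4
  }

lemma4p3 : (WellRounded 2 4 × MinDist2 2 4) ×
    (WellRounded 3 3 × MinDist2 3 3) ×
    (WellRounded 4 4 × MinDist2 4 4)
lemma4p3 =
  certified certificate24 (toWitness {a? = valid? certificate24} tt) zero ,
  certified certificate33 (toWitness {a? = valid? certificate33} tt) zero ,
  certified certificate44 (toWitness {a? = valid? certificate44} tt) zero
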